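{- Let $n_1,\ldots,n_k$ be positive integers and let $G=K_{n_1,\ldots,n_k}$. Put $\sigma_0=1$, $n=\sigma_1=\sum_{i=1}^k n_i$, and $\sigma_i=\sum_{1\leq j_1<\cdots<j_i\leq k} n_{j_1}\cdots n_{j_i}$ for $i=2,\ldots,k$. Then $$S_G(\lambda)=(\lambda +1)^{n-k} \Big(\lambda^k+(k-n)\lambda^{k-1}+\big(\tbinom{k}{2}-(k-1)n\big)\lambda^{k-2}+\sum_{m=3}^{k}\sum_{i=0}^{m}(-1)^{i-1}2^{i-1}\tbinom{k-i}{m-i}(i-2)\sigma_i\lambda^{k-m}\Big).$$
   Context: For a simple graph $G$ with adjacency matrix $A(G)$, the Seidel matrix is $S(G)=J-I-2A(G)$, where $I$ is the identity matrix and $J$ the all-ones matrix. The Seidel characteristic polynomial is $S_G(\lambda)=\det(\lambda I-S(G))$. The complete multipartite graph $K_{n_1,\ldots,n_k}$ has vertex set partitioned into parts of sizes $n_1,\ldots,n_k$, two vertices being adjacent iff they lie in different parts. -}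

module Defs where

open import Data.Nat as ℕ using (ℕ; zero; suc; _∸_)
open import Data.Nat.Combinatorics using (_C_)
open import Data.Integer as ℤ using (ℤ; +_; -[1+_])
open import Data.Fin using (Fin; zero; suc; splitAt; punchIn; _≟_)
open import Data.Vec using (Vec; []; _∷_; sum)
open import Data.Sum using (inj₁; inj₂)
open import Relation.Nullary using (yes; no)
open import Algebra.Bundles using (CommutativeRing)

-- The complete multipartite graph K_{n_1,...,n_k}
-- Vertex set: Fin (n_1 + ... + n_k); the first n_1 vertices form part 0,
-- the next n_2 vertices part 1, etc.

partOf : ∀ {k} (ns : Vec ℕ k) → Fin (sum ns) → Fin k
partOf (m ∷ ns) v with splitAt m v
... | inj₁ _ = zero
... | inj₂ w = suc (partOf ns w)

adjMat : ∀ {k} (ns : Vec ℕ k) → Fin (sum ns) → Fin (sum ns) → ℤ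
adjMat ns u v with partOf ns u ≟ partOf ns v
... | yes _ = + 0
... | no _  = + 1

idMat : ∀ {N} → Fin N → Fin N → ℤ
idMat u v with u ≟ v
... | yes _ = + 1
... | no _  = + 0

seidel : ∀ {k} (ns : Vec ℕ k) → Fin (sum ns) → Fin (sum ns) → ℤ
seidel ns u v = (+ 1 ℤ.- idMat u v) ℤ.- (+ 2 ℤ.* adjMat ns u v)

σ : ∀ {k} → Vec ℕ k → ℕ → ℕ
σ []       zero    = 1
σ []       (suc i) = 0
σ (x ∷ xs) zero    = 1
σ (x ∷ xs) (suc i) = σ xs (suc i) ℕ.+ x ℕ.* σ xs i

sumℤ : ℕ → (ℕ → ℤ) → ℤ
sumℤ zero    f = f 0
sumℤ (suc m) f = sumℤ m f ℤ.+ f (suc m)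

-- the summand (-1)^{i-1} 2^{i-1} binom(k-i, m-i) (i-2) σ_i ;
-- for i = 0 this literally equals (-1)^{-1} 2^{-1} binom(k,m) (-2) σ_0 = binom(k,m)
term : ∀ {k} → Vec ℕ k → ℕ → ℕ → ℤ
term {k} ns m zero    = + (k C m)
term {k} ns m (suc j) =
  ((((ℤ.- (+ 1)) ℤ.^ j) ℤ.* (+ (2 ℕ.^ j))) ℤ.* (+ ((k ∸ suc j) C (m ∸ suc j))))
    ℤ.* ((+ (suc j) ℤ.- + 2) ℤ.* (+ σ ns (suc j)))

coeff : ∀ {k} → Vec ℕ k → ℕ → ℤ
coeff {k} ns 0 = + 1
coeff {k} ns 1 = + k ℤ.- + sum ns
coeff {k} ns 2 = + (k C 2) ℤ.- (+ (k ∸ 1) ℤ.* + sum ns)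
coeff {k} ns m@(suc (suc (suc _))) = sumℤ m (term ns m)

module RingDefs {c ℓ} (R : CommutativeRing c ℓ) where
  open CommutativeRing R hiding (zero)

  ℕ→R : ℕ → Carrier
  ℕ→R zero    = 0#
  ℕ→R (suc n) = 1# + ℕ→R n

  ℤ→R : ℤ → Carrier
  ℤ→R (+ n)      = ℕ→R n
  ℤ→R -[1+ n ]   = - ℕ→R (suc n)

  pow : Carrier → ℕ → Carrier
  pow x zero    = 1#
  pow x (suc n) = x * pow x n

  ΣFin : ∀ n → (Fin n → Carrier) → Carrier
  ΣFin zero    f = 0#
  ΣFin (suc n) f = f zero + ΣFin n (λ i → f (suc i))

  ΣR : ℕ → (ℕ → Carrier) → Carrier
  ΣR zero    f = f 0
  ΣR (suc n) f = ΣR n f + f (suc n)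

  altSign : ∀ {n} → Fin n → Carrier
  altSign zero    = 1#
  altSign (suc j) = - altSign j

  det : ∀ n → (Fin n → Fin n → Carrier) → Carrier
  det zero    M = 1#
  det (suc n) M = ΣFin (suc n) (λ j → (altSign j * M zero j) * det n (λ a b → M (suc a) (punchIn j b)))

  charMat : ∀ {k} (ns : Vec ℕ k) → Carrier → Fin (sum ns) → Fin (sum ns) → Carrier
  charMat ns x u v = (x * ℤ→R (idMat u v)) - ℤ→R (seidel ns u v)

  seidelCharPoly : ∀ {k} (ns : Vec ℕ k) → Carrier → Carrier
  seidelCharPoly ns x = det (sum ns) (charMat ns x)

  rhs : ∀ {k} (ns : Vec ℕ k) → Carrier → Carrier
  rhs {k} ns x = pow (x + 1#) (sum ns ∸ k) * ΣR k (λ m → ℤ→R (coeff ns m) * pow x (k ∸ m))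

-- Put y = λ + 1 and let B be the 0/1 matrix of the relation "same part", so that
-- λ I - S(G) = y I + J - 2 B. For D(n₁ ∷ r; t) = det (y I + t J - 2 B), subtracting the second row from
-- the first (both in the first part) gives D(m+2 ∷ r) = 2y D(m+1 ∷ r) - y² D(m ∷ r), and for a
-- singleton first part a Schur complement gives D(1 ∷ r; t) = (y - 2) D(r; t) + t D(r; 0).
-- Hence D(n ∷ r; t) = y^(n-1) ((y - 2n) D(r; t) + t n D(r; 0)), and induction over the parts gives
-- D(t) = y^(N-k) Σᵢ (w₀ i + t (w₁ i - w₀ i)) σᵢ y^(k-i) with w₀ i = (-2)^i, w₁ i = (-2)^(i-1) (i-2).
-- At t = 1, expanding y^(k-i) = (λ + 1)^(k-i) binomially and collecting powers of λ yields the
-- coefficients of the theorem.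

module Submission where

open import Defs
open import Data.Nat as ℕ using (ℕ; zero; suc; _∸_; _≤_; z≤n; s≤s)
import Data.Nat.Properties as ℕ
open import Data.Nat.Combinatorics using (_C_; nC1≡n)
open import Data.Integer as ℤ using (ℤ; +_; -[1+_])
import Data.Integer.Properties as ℤ
open import Data.Fin as Fin using (Fin; zero; suc; punchIn; toℕ; splitAt)
import Data.Fin.Properties as Fin
open import Data.Vec using (Vec; []; _∷_; sum)
open import Data.Vec.Relation.Unary.All using (All; []; _∷_)
open import Data.Sum using (inj₁; inj₂)
open import Data.Maybe using (Maybe; just; nothing)
open import Data.Empty using (⊥-elim)
open import Function using (_∘_)
open import Relation.Binary.PropositionalEquality as ≡ using (_≡_; _≢_)
open import Relation.Nullary using (yes; no; ¬_)
open import Algebra.Bundles using (CommutativeRing)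
import Algebra.Solver.Ring
open import Algebra.Solver.Ring.AlmostCommutativeRing using (fromCommutativeRing; _-Raw-AlmostCommutative⟶_)

module IntegerEmbedding {c ℓ} (R : CommutativeRing c ℓ) where
  open CommutativeRing R hiding (zero)
  open RingDefs R
  open import Algebra.Properties.Ring ring using (-0#≈0#; -‿involutive; -‿distribˡ-*; -‿+-comm)
  open import Algebra.Properties.AbelianGroup +-abelianGroup using (xyx⁻¹≈y)
  open import Algebra.Properties.Semiring.Mult semiring using (_×_; ×1-homo-*)
  open import Algebra.Properties.Monoid.Mult +-monoid using (×-homo-+)
  open import Relation.Binary.Reasoning.Setoid setoid

  ℕ→R≡×1# : ∀ n → ℕ→R n ≡ n × 1#
  ℕ→R≡×1# zero    = ≡.refl
  ℕ→R≡×1# (suc n) = ≡.cong (λ r → 1# + r) (ℕ→R≡×1# n)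

  ℕ→R-+ : ∀ m n → ℕ→R (m ℕ.+ n) ≈ ℕ→R m + ℕ→R n
  ℕ→R-+ m n rewrite ℕ→R≡×1# (m ℕ.+ n) | ℕ→R≡×1# m | ℕ→R≡×1# n = ×-homo-+ 1# m n

  ℕ→R-* : ∀ m n → ℕ→R (m ℕ.* n) ≈ ℕ→R m * ℕ→R n
  ℕ→R-* m n rewrite ℕ→R≡×1# (m ℕ.* n) | ℕ→R≡×1# m | ℕ→R≡×1# n = ×1-homo-* m n

  ℤ→R-neg : ∀ i → ℤ→R (ℤ.- i) ≈ - ℤ→R i
  ℤ→R-neg (+ zero)  = sym -0#≈0#
  ℤ→R-neg (+ suc n) = refl
  ℤ→R-neg -[1+ n ]  = sym (-‿involutive _)

  ℤ→R-⊖ : ∀ m n → ℤ→R (m ℤ.⊖ n) ≈ ℕ→R m - ℕ→R n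
  ℤ→R-⊖ m       zero    = sym (trans (+-congˡ -0#≈0#) (+-identityʳ _))
  ℤ→R-⊖ zero    (suc n) = sym (+-identityˡ _)
  ℤ→R-⊖ (suc m) (suc n) rewrite ℤ.[1+m]⊖[1+n]≡m⊖n m n = begin
    ℤ→R (m ℤ.⊖ n)                     ≈⟨ ℤ→R-⊖ m n ⟩
    ℕ→R m - ℕ→R n                     ≈⟨ +-congʳ (xyx⁻¹≈y 1# (ℕ→R m)) ⟨
    ((1# + ℕ→R m) - 1#) - ℕ→R n       ≈⟨ +-assoc _ _ _ ⟩
    (1# + ℕ→R m) + (- 1# - ℕ→R n)     ≈⟨ +-congˡ (-‿+-comm 1# (ℕ→R n)) ⟩
    (1# + ℕ→R m) - (1# + ℕ→R n)       ∎

  ℤ→R-+ : ∀ i j → ℤ→R (i ℤ.+ j) ≈ ℤ→R i + ℤ→R j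
  ℤ→R-+ -[1+ m ] -[1+ n ] = begin
    ℤ→R (-[1+ m ] ℤ.+ -[1+ n ])           ≡⟨ ≡.cong ℤ→R (ℤ.neg-distrib-+ (+ suc m) (+ suc n)) ⟨
    - ℕ→R (suc m ℕ.+ suc n)               ≈⟨ -‿cong (ℕ→R-+ (suc m) (suc n)) ⟩
    - (ℕ→R (suc m) + ℕ→R (suc n))         ≈⟨ -‿+-comm _ _ ⟨
    - ℕ→R (suc m) - ℕ→R (suc n)           ∎
  ℤ→R-+ -[1+ m ] (+ n)    = trans (ℤ→R-⊖ n (suc m)) (+-comm _ _)
  ℤ→R-+ (+ m)    -[1+ n ] = ℤ→R-⊖ m (suc n)
  ℤ→R-+ (+ m)    (+ n)    = ℕ→R-+ m n

  ℤ→R-sub : ∀ i j → ℤ→R (i ℤ.- j) ≈ ℤ→R i - ℤ→R j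
  ℤ→R-sub i j = trans (ℤ→R-+ i (ℤ.- j)) (+-congˡ (ℤ→R-neg j))

  ℤ→R-*ℕ : ∀ m j → ℤ→R (+ m ℤ.* j) ≈ ℕ→R m * ℤ→R j
  ℤ→R-*ℕ zero    j = sym (zeroˡ _)
  ℤ→R-*ℕ (suc m) j = begin
    ℤ→R (+ suc m ℤ.* j)              ≡⟨ ≡.cong ℤ→R (ℤ.suc-* (+ m) j) ⟩
    ℤ→R (j ℤ.+ + m ℤ.* j)            ≈⟨ ℤ→R-+ j (+ m ℤ.* j) ⟩
    ℤ→R j + ℤ→R (+ m ℤ.* j)          ≈⟨ +-cong (sym (*-identityˡ _)) (ℤ→R-*ℕ m j) ⟩
    1# * ℤ→R j + ℕ→R m * ℤ→R j       ≈⟨ distribʳ _ _ _ ⟨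
    (1# + ℕ→R m) * ℤ→R j             ∎

  ℤ→R-* : ∀ i j → ℤ→R (i ℤ.* j) ≈ ℤ→R i * ℤ→R j
  ℤ→R-* (+ m)    j = ℤ→R-*ℕ m j
  ℤ→R-* -[1+ m ] j = begin
    ℤ→R (-[1+ m ] ℤ.* j)             ≡⟨ ≡.cong ℤ→R (ℤ.neg-distribˡ-* (+ suc m) j) ⟨
    ℤ→R (ℤ.- (+ suc m ℤ.* j))        ≈⟨ ℤ→R-neg (+ suc m ℤ.* j) ⟩
    - ℤ→R (+ suc m ℤ.* j)            ≈⟨ -‿cong (ℤ→R-*ℕ (suc m) j) ⟩
    - (ℕ→R (suc m) * ℤ→R j)          ≈⟨ -‿distribˡ-* _ _ ⟩
    - ℕ→R (suc m) * ℤ→R j            ∎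

  ℤ→R-^ : ∀ i n → ℤ→R (i ℤ.^ n) ≈ pow (ℤ→R i) n
  ℤ→R-^ i zero    = +-identityʳ 1#
  ℤ→R-^ i (suc n) = trans (ℤ→R-* i (i ℤ.^ n)) (*-congˡ (ℤ→R-^ i n))

  ℤ→R-homomorphism : CommutativeRing.rawRing ℤ.+-*-commutativeRing -Raw-AlmostCommutative⟶ fromCommutativeRing R
  ℤ→R-homomorphism = record
    { ⟦_⟧ = ℤ→R ; +-homo = ℤ→R-+ ; *-homo = ℤ→R-* ; -‿homo = ℤ→R-neg ; 0-homo = refl ; 1-homo = +-identityʳ 1# }

  -- The solver only needs a sound coefficient test, so integers are compared syntactically.
  ℤ→R-≟ : ∀ i j → Maybe (ℤ→R i ≈ ℤ→R j)
  ℤ→R-≟ i j with i ℤ.≟ j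
  ... | yes ≡.refl = just refl
  ... | no _       = nothing

  open Algebra.Solver.Ring _ (fromCommutativeRing R) ℤ→R-homomorphism ℤ→R-≟ public
    using (solve; _:=_; _:+_; _:*_; :-_; _:-_; con)

module Determinant {c ℓ} (R : CommutativeRing c ℓ) where
  open CommutativeRing R hiding (zero)
  open RingDefs R
  open IntegerEmbedding R using (solve; _:=_; _:+_; _:*_; :-_; con)
  open import Algebra.Properties.Ring ring using (-0#≈0#; -‿involutive; -‿+-comm; -‿distribʳ-*)
  open import Relation.Binary.Reasoning.Setoid setoid

  ΣFin-cong : ∀ n {f g : Fin n → Carrier} → (∀ i → f i ≈ g i) → ΣFin n f ≈ ΣFin n g
  ΣFin-cong zero    f≈g = refl
  ΣFin-cong (suc n) f≈g = +-cong (f≈g zero) (ΣFin-cong n (λ i → f≈g (suc i)))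

  ΣFin-≈0 : ∀ n {f : Fin n → Carrier} → (∀ i → f i ≈ 0#) → ΣFin n f ≈ 0#
  ΣFin-≈0 zero    f≈0 = refl
  ΣFin-≈0 (suc n) f≈0 = trans (+-cong (f≈0 zero) (ΣFin-≈0 n (λ i → f≈0 (suc i)))) (+-identityˡ 0#)

  ΣFin-+ : ∀ n (f g : Fin n → Carrier) → ΣFin n (λ i → f i + g i) ≈ ΣFin n f + ΣFin n g
  ΣFin-+ zero    f g = sym (+-identityˡ 0#)
  ΣFin-+ (suc n) f g = trans (+-congˡ (ΣFin-+ n _ _)) (interchange _ _ _ _)
    where
    interchange : ∀ a b c d → (a + b) + (c + d) ≈ (a + c) + (b + d)
    interchange = solve 4 (λ a b c d → (a :+ b) :+ (c :+ d) := (a :+ c) :+ (b :+ d)) refl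

  ΣFin-*ˡ : ∀ n a (f : Fin n → Carrier) → ΣFin n (λ i → a * f i) ≈ a * ΣFin n f
  ΣFin-*ˡ zero    a f = sym (zeroʳ a)
  ΣFin-*ˡ (suc n) a f = trans (+-congˡ (ΣFin-*ˡ n a _)) (sym (distribˡ _ _ _))

  ΣFin-neg : ∀ n (f : Fin n → Carrier) → ΣFin n (λ i → - f i) ≈ - ΣFin n f
  ΣFin-neg zero    f = sym -0#≈0#
  ΣFin-neg (suc n) f = trans (+-congˡ (ΣFin-neg n _)) (-‿+-comm _ _)

  ΣFin-comm : ∀ m n (f : Fin m → Fin n → Carrier) →
    ΣFin m (λ i → ΣFin n (f i)) ≈ ΣFin n (λ j → ΣFin m (λ i → f i j))
  ΣFin-comm zero    n f = sym (ΣFin-≈0 n (λ _ → refl))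
  ΣFin-comm (suc m) n f = trans (+-congˡ (ΣFin-comm m n _)) (sym (ΣFin-+ n _ _))

  Mat : ℕ → Set c
  Mat n = Fin n → Fin n → Carrier

  minor : ∀ {n} → Mat (suc n) → Fin (suc n) → Mat n
  minor M j a b = M (suc a) (punchIn j b)

  expansionTerm : ∀ {n} → Mat (suc n) → Fin (suc n) → Carrier
  expansionTerm {n} M j = (altSign j * M zero j) * det n (minor M j)

  transpose : ∀ {n} → Mat n → Mat n
  transpose M a b = M b a

  det-cong : ∀ n {M N : Mat n} → (∀ a b → M a b ≈ N a b) → det n M ≈ det n N
  det-cong zero    M≈N = refl
  det-cong (suc n) M≈N = ΣFin-cong (suc n) (λ j →
    *-cong (*-congˡ {altSign j} (M≈N zero j)) (det-cong n (λ a b → M≈N (suc a) (punchIn j b))))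

  columnExpansion : ∀ n → Mat (suc n) → Carrier
  columnExpansion n M =
    ΣFin (suc n) (λ i → (altSign i * M i zero) * det n (λ a b → M (punchIn i a) (suc b)))

  -- Expanding twice, along row 0 and column 0, gives the same double sum over the entries
  -- M 0 (1+l) and M (1+i) 0; the two sign changes cancel.
  det≈columnExpansion : ∀ n (M : Mat (suc n)) → det (suc n) M ≈ columnExpansion n M
  det≈columnExpansion zero    M = refl
  det≈columnExpansion (suc n) M = +-congˡ (begin
      ΣFin (suc n) (λ l → r l * det (suc n) (minor M (suc l)))
    ≈⟨ ΣFin-cong (suc n) (λ l → *-congˡ {r l} (det≈columnExpansion n (minor M (suc l)))) ⟩
      ΣFin (suc n) (λ l → r l * ΣFin (suc n) (λ i → (altSign i * M (suc i) zero) * D i l))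
    ≈⟨ ΣFin-cong (suc n) (λ l → ΣFin-*ˡ (suc n) (r l) (λ i → (altSign i * M (suc i) zero) * D i l)) ⟨
      ΣFin (suc n) (λ l → ΣFin (suc n) (λ i → r l * ((altSign i * M (suc i) zero) * D i l)))
    ≈⟨ ΣFin-comm (suc n) (suc n) (λ l i → r l * ((altSign i * M (suc i) zero) * D i l)) ⟩
      ΣFin (suc n) (λ i → ΣFin (suc n) (λ l → r l * ((altSign i * M (suc i) zero) * D i l)))
    ≈⟨ ΣFin-cong (suc n) (λ i → ΣFin-cong (suc n) (λ l →
         exchangeSigns (altSign l) (M zero (suc l)) (altSign i) (M (suc i) zero) (D i l))) ⟩
      ΣFin (suc n) (λ i → ΣFin (suc n) (λ l → k i * ((altSign l * M zero (suc l)) * D i l)))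
    ≈⟨ ΣFin-cong (suc n) (λ i → ΣFin-*ˡ (suc n) (k i) (λ l → (altSign l * M zero (suc l)) * D i l)) ⟩
      ΣFin (suc n) (λ i → k i * det (suc n) (λ a b → M (punchIn (suc i) a) (suc b)))
    ∎)
    where
    r k : Fin (suc n) → Carrier
    r l = altSign (suc l) * M zero (suc l)
    k i = altSign (suc i) * M (suc i) zero
    D : Fin (suc n) → Fin (suc n) → Carrier
    D i l = det n (λ a b → M (suc (punchIn i a)) (suc (punchIn l b)))
    exchangeSigns : ∀ s A s′ B d → (- s * A) * ((s′ * B) * d) ≈ (- s′ * B) * ((s * A) * d)
    exchangeSigns = solve 5 (λ s A s′ B d →
      ((:- s) :* A) :* ((s′ :* B) :* d) := ((:- s′) :* B) :* ((s :* A) :* d)) refl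

  det-transpose : ∀ n (M : Mat n) → det n (transpose M) ≈ det n M
  det-transpose zero    M = refl
  det-transpose (suc n) M = trans
    (ΣFin-cong (suc n) (λ j → *-congˡ {altSign j * M j zero} (det-transpose n (λ a b → M (punchIn j a) (suc b)))))
    (sym (det≈columnExpansion n M))

  swap₀₁ : ∀ {n} → Fin (suc (suc n)) → Fin (suc (suc n))
  swap₀₁ zero          = suc zero
  swap₀₁ (suc zero)    = zero
  swap₀₁ (suc (suc b)) = suc (suc b)

  swapCols₀₁ : ∀ {n} → Mat (suc (suc n)) → Mat (suc (suc n))
  swapCols₀₁ M a b = M a (swap₀₁ b)

  expansionFrom₂ : ∀ n → Mat (suc (suc n)) → Carrier
  expansionFrom₂ n M = ΣFin n (λ j → expansionTerm M (suc (suc j)))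

  det-swapCols₀₁ : ∀ n (M : Mat (suc (suc n))) → det (suc (suc n)) (swapCols₀₁ M) ≈ - det (suc (suc n)) M
  expansionFrom₂-swapCols₀₁ : ∀ n (M : Mat (suc (suc n))) →
    expansionFrom₂ n (swapCols₀₁ M) ≈ - expansionFrom₂ n M

  det-swapCols₀₁ n M = begin
      (s * M zero (suc zero)) * det (suc n) (minor (swapCols₀₁ M) zero)
        + ((- s * M zero zero) * det (suc n) (minor (swapCols₀₁ M) (suc zero)) + expansionFrom₂ n (swapCols₀₁ M))
    ≈⟨ +-cong (*-congˡ {s * M zero (suc zero)} (det-cong (suc n) minor₀))
              (+-cong (*-congˡ { - s * M zero zero} (det-cong (suc n) minor₁)) (expansionFrom₂-swapCols₀₁ n M)) ⟩
      (s * M zero (suc zero)) * det (suc n) (minor M (suc zero))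
        + ((- s * M zero zero) * det (suc n) (minor M zero) + - expansionFrom₂ n M)
    ≈⟨ antisymmetry s (M zero zero) (M zero (suc zero)) _ _ _ ⟩
      - det (suc (suc n)) M ∎
    where
    s = altSign {suc (suc n)} zero
    minor₀ : ∀ a b → minor (swapCols₀₁ M) zero a b ≈ minor M (suc zero) a b
    minor₀ a zero    = refl
    minor₀ a (suc b) = refl
    minor₁ : ∀ a b → minor (swapCols₀₁ M) (suc zero) a b ≈ minor M zero a b
    minor₁ a zero    = refl
    minor₁ a (suc b) = refl
    antisymmetry : ∀ s A B d₀ d₁ S →
      (s * B) * d₁ + ((- s * A) * d₀ + - S) ≈ - ((s * A) * d₀ + ((- s * B) * d₁ + S))
    antisymmetry = solve 6 (λ s A B d₀ d₁ S →
      (s :* B) :* d₁ :+ (((:- s) :* A) :* d₀ :+ (:- S)) := :- ((s :* A) :* d₀ :+ (((:- s) :* B) :* d₁ :+ S))) refl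

  expansionFrom₂-swapCols₀₁ zero    M = sym -0#≈0#
  expansionFrom₂-swapCols₀₁ (suc n) M = trans
    (ΣFin-cong (suc n) (λ j → trans
      (*-congˡ {weight j} (trans (det-cong (suc (suc n)) (minor-swap j)) (det-swapCols₀₁ n (minor M (suc (suc j))))))
      (sym (-‿distribʳ-* (weight j) _))))
    (ΣFin-neg (suc n) (λ j → expansionTerm M (suc (suc j))))
    where
    weight : Fin (suc n) → Carrier
    weight j = altSign (suc (suc j)) * M zero (suc (suc j))
    minor-swap : ∀ j a b → minor (swapCols₀₁ M) (suc (suc j)) a b ≈ swapCols₀₁ (minor M (suc (suc j))) a b
    minor-swap j a zero          = refl
    minor-swap j a (suc zero)    = refl
    minor-swap j a (suc (suc b)) = refl

  det-col₀≈col₁⇒≈0 : ∀ n (M : Mat (suc (suc n))) → (∀ a → M a zero ≈ M a (suc zero)) → det (suc (suc n)) M ≈ 0#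
  expansionFrom₂-col₀≈col₁⇒≈0 : ∀ n (M : Mat (suc (suc n))) → (∀ a → M a zero ≈ M a (suc zero)) →
    expansionFrom₂ n M ≈ 0#

  det-col₀≈col₁⇒≈0 n M col₀≈col₁ = begin
      (s * M zero zero) * det (suc n) (minor M zero)
        + ((- s * M zero (suc zero)) * det (suc n) (minor M (suc zero)) + expansionFrom₂ n M)
    ≈⟨ +-cong (*-congˡ {s * M zero zero} (det-cong (suc n) minor₀≈minor₁))
              (+-cong (*-congʳ (*-congˡ { - s} (sym (col₀≈col₁ zero))))
                      (expansionFrom₂-col₀≈col₁⇒≈0 n M col₀≈col₁)) ⟩
      (s * M zero zero) * d + ((- s * M zero zero) * d + 0#)
    ≈⟨ cancel s (M zero zero) d ⟩
      0# ∎
    where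
    s = altSign {suc (suc n)} zero
    d = det (suc n) (minor M (suc zero))
    minor₀≈minor₁ : ∀ a b → minor M zero a b ≈ minor M (suc zero) a b
    minor₀≈minor₁ a zero    = sym (col₀≈col₁ (suc a))
    minor₀≈minor₁ a (suc b) = refl
    cancel : ∀ s A d → (s * A) * d + ((- s * A) * d + 0#) ≈ 0#
    cancel = solve 3 (λ s A d → (s :* A) :* d :+ (((:- s) :* A) :* d :+ con (ℤ.+ 0)) := con (ℤ.+ 0)) refl

  expansionFrom₂-col₀≈col₁⇒≈0 zero    M col₀≈col₁ = refl
  expansionFrom₂-col₀≈col₁⇒≈0 (suc n) M col₀≈col₁ = ΣFin-≈0 (suc n) (λ j → trans
    (*-congˡ {altSign (suc (suc j)) * M zero (suc (suc j))}
      (det-col₀≈col₁⇒≈0 n (minor M (suc (suc j))) (λ a → col₀≈col₁ (suc a))))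
    (zeroʳ _))

  det-col₀≈col⇒≈0 : ∀ n (M : Mat (suc n)) (j : Fin n) → (∀ a → M a zero ≈ M a (suc j)) → det (suc n) M ≈ 0#
  det-col₀≈col⇒≈0 (suc n)       M zero    col₀≈col = det-col₀≈col₁⇒≈0 n M col₀≈col
  det-col₀≈col⇒≈0 (suc (suc n)) M (suc j) col₀≈col = begin
      det (suc (suc (suc n))) M                 ≈⟨ -‿involutive _ ⟨
      - - det (suc (suc (suc n))) M             ≈⟨ -‿cong (det-swapCols₀₁ (suc n) M) ⟨
      - det (suc (suc (suc n))) M′              ≈⟨ -‿cong (det≈columnExpansion (suc (suc n)) M′) ⟩
      - columnExpansion (suc (suc n)) M′        ≈⟨ -‿cong (ΣFin-≈0 (suc (suc (suc n))) term≈0) ⟩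
      - 0#                                      ≈⟨ -0#≈0# ⟩
      0#                                        ∎
    where
    M′ = swapCols₀₁ M
    -- after the swap, every column minor still contains the original columns 0 and 2+j
    term≈0 : ∀ i → (altSign i * M′ i zero) * det (suc (suc n)) (λ a b → M′ (punchIn i a) (suc b)) ≈ 0#
    term≈0 i = trans
      (*-congˡ (det-col₀≈col⇒≈0 (suc n) (λ a b → M′ (punchIn i a) (suc b)) j (λ a → col₀≈col (punchIn i a))))
      (zeroʳ _)

  det-row₀≈row⇒≈0 : ∀ n (M : Mat (suc n)) (j : Fin n) → (∀ b → M zero b ≈ M (suc j) b) → det (suc n) M ≈ 0#
  det-row₀≈row⇒≈0 n M j row₀≈row =
    trans (det-transpose (suc n) (transpose M)) (det-col₀≈col⇒≈0 n (transpose M) j row₀≈row)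

  ΣFin-linear : ∀ n α (f g : Fin n → Carrier) → ΣFin n (λ j → α * f j + g j) ≈ α * ΣFin n f + ΣFin n g
  ΣFin-linear n α f g = trans (ΣFin-+ n (λ j → α * f j) g) (+-congʳ (ΣFin-*ˡ n α f))

  det-linearInRow : ∀ n (r : Fin n) (M U W : Mat n) α →
    (∀ b → M r b ≈ α * U r b + W r b) →
    (∀ a b → a ≢ r → M a b ≈ U a b) → (∀ a b → a ≢ r → M a b ≈ W a b) →
    det n M ≈ α * det n U + det n W
  det-linearInRow (suc n) zero M U W α row≈ M≈U M≈W =
    trans (ΣFin-cong (suc n) term≈) (ΣFin-linear (suc n) α (expansionTerm U) (expansionTerm W))
    where
    spread : ∀ s α A B d → (s * (α * A + B)) * d ≈ α * ((s * A) * d) + (s * B) * d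
    spread = solve 5 (λ s α A B d → (s :* (α :* A :+ B)) :* d := α :* ((s :* A) :* d) :+ (s :* B) :* d) refl
    term≈ : ∀ j → expansionTerm M j ≈ α * expansionTerm U j + expansionTerm W j
    term≈ j = begin
        (altSign j * M zero j) * det n (minor M j)
      ≈⟨ *-congʳ (*-congˡ {altSign j} (row≈ j)) ⟩
        (altSign j * (α * U zero j + W zero j)) * det n (minor M j)
      ≈⟨ spread (altSign j) α (U zero j) (W zero j) _ ⟩
        α * ((altSign j * U zero j) * det n (minor M j)) + (altSign j * W zero j) * det n (minor M j)
      ≈⟨ +-cong (*-congˡ {α} (*-congˡ {altSign j * U zero j} (det-cong n (λ a b → M≈U (suc a) (punchIn j b) λ ()))))
                (*-congˡ {altSign j * W zero j} (det-cong n (λ a b → M≈W (suc a) (punchIn j b) λ ()))) ⟩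
        α * expansionTerm U j + expansionTerm W j ∎
  det-linearInRow (suc n) (suc r) M U W α row≈ M≈U M≈W =
    trans (ΣFin-cong (suc n) term≈) (ΣFin-linear (suc n) α (expansionTerm U) (expansionTerm W))
    where
    spread : ∀ s A α d e → (s * A) * (α * d + e) ≈ α * ((s * A) * d) + (s * A) * e
    spread = solve 5 (λ s A α d e → (s :* A) :* (α :* d :+ e) := α :* ((s :* A) :* d) :+ (s :* A) :* e) refl
    term≈ : ∀ j → expansionTerm M j ≈ α * expansionTerm U j + expansionTerm W j
    term≈ j = begin
        (altSign j * M zero j) * det n (minor M j)
      ≈⟨ *-congˡ {altSign j * M zero j} (det-linearInRow n r (minor M j) (minor U j) (minor W j) α
           (λ b → row≈ (punchIn j b))
           (λ a b a≢r → M≈U (suc a) (punchIn j b) (λ e → a≢r (Fin.suc-injective e)))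
           (λ a b a≢r → M≈W (suc a) (punchIn j b) (λ e → a≢r (Fin.suc-injective e)))) ⟩
        (altSign j * M zero j) * (α * det n (minor U j) + det n (minor W j))
      ≈⟨ spread (altSign j) (M zero j) α _ _ ⟩
        α * ((altSign j * M zero j) * det n (minor U j)) + (altSign j * M zero j) * det n (minor W j)
      ≈⟨ +-cong (*-congˡ {α} (*-congʳ (*-congˡ {altSign j} (M≈U zero j λ ()))))
                (*-congʳ (*-congˡ {altSign j} (M≈W zero j λ ()))) ⟩
        α * expansionTerm U j + expansionTerm W j ∎

  det-row₀-supportedOn₀ : ∀ n (M : Mat (suc n)) → (∀ b → M zero (suc b) ≈ 0#) →
    det (suc n) M ≈ M zero zero * det n (minor M zero)
  det-row₀-supportedOn₀ n M row₀≈0 = begin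
      (1# * M zero zero) * det n (minor M zero) + ΣFin n (λ j → expansionTerm M (suc j))
    ≈⟨ +-cong (*-congʳ (*-identityˡ _)) (ΣFin-≈0 n (λ j → trans
         (*-congʳ (trans (*-congˡ {altSign (suc j)} (row₀≈0 j)) (zeroʳ _))) (zeroˡ _))) ⟩
      M zero zero * det n (minor M zero) + 0#
    ≈⟨ +-identityʳ _ ⟩
      M zero zero * det n (minor M zero) ∎

  det-row₀-supportedOn₀₁ : ∀ n (M : Mat (suc (suc n))) → (∀ b → M zero (suc (suc b)) ≈ 0#) →
    det (suc (suc n)) M ≈ M zero zero * det (suc n) (minor M zero) - M zero (suc zero) * det (suc n) (minor M (suc zero))
  det-row₀-supportedOn₀₁ n M row₀≈0 = begin
      (1# * M zero zero) * det (suc n) (minor M zero)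
        + ((- 1# * M zero (suc zero)) * det (suc n) (minor M (suc zero)) + expansionFrom₂ n M)
    ≈⟨ +-congˡ (+-congˡ (ΣFin-≈0 n (λ j → trans
         (*-congʳ (trans (*-congˡ {altSign (suc (suc j))} (row₀≈0 j)) (zeroʳ _))) (zeroˡ _)))) ⟩
      (1# * M zero zero) * det (suc n) (minor M zero)
        + ((- 1# * M zero (suc zero)) * det (suc n) (minor M (suc zero)) + 0#)
    ≈⟨ signs 1# (M zero zero) (M zero (suc zero)) _ _ ⟩
      1# * (M zero zero * det (suc n) (minor M zero) - M zero (suc zero) * det (suc n) (minor M (suc zero)))
    ≈⟨ *-identityˡ _ ⟩
      M zero zero * det (suc n) (minor M zero) - M zero (suc zero) * det (suc n) (minor M (suc zero)) ∎
    where
    signs : ∀ o A B d e → (o * A) * d + ((- o * B) * e + 0#) ≈ o * (A * d - B * e)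
    signs = solve 5 (λ o A B d e →
      (o :* A) :* d :+ (((:- o) :* B) :* e :+ con (ℤ.+ 0)) := o :* (A :* d :+ (:- (B :* e)))) refl

  det-col₀-supportedOn₀ : ∀ n (M : Mat (suc n)) → (∀ a → M (suc a) zero ≈ 0#) →
    det (suc n) M ≈ M zero zero * det n (minor M zero)
  det-col₀-supportedOn₀ n M col₀≈0 = begin
    det (suc n) M                                        ≈⟨ det-transpose (suc n) M ⟨
    det (suc n) (transpose M)                            ≈⟨ det-row₀-supportedOn₀ n (transpose M) col₀≈0 ⟩
    M zero zero * det n (transpose (minor M zero))       ≈⟨ *-congˡ (det-transpose n (minor M zero)) ⟩
    M zero zero * det n (minor M zero)                   ∎

  det-scaleRow₀ : ∀ n (M N : Mat (suc n)) α → (∀ b → N zero b ≈ α * M zero b) →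
    (∀ a b → N (suc a) b ≈ M (suc a) b) → det (suc n) N ≈ α * det (suc n) M
  det-scaleRow₀ n M N α row₀≈ rest≈ = trans
    (ΣFin-cong (suc n) (λ j → trans
      (*-cong (*-congˡ {altSign j} (row₀≈ j)) (det-cong n (λ a b → rest≈ a (punchIn j b))))
      (factor (altSign j) α (M zero j) _)))
    (ΣFin-*ˡ (suc n) α (expansionTerm M))
    where
    factor : ∀ s α A d → (s * (α * A)) * d ≈ α * ((s * A) * d)
    factor = solve 4 (λ s α A d → (s :* (α :* A)) :* d := α :* ((s :* A) :* d)) refl

  withRow₀ : ∀ {n} → (Fin (suc n) → Carrier) → Mat (suc n) → Mat (suc n)
  withRow₀ v M zero    b = v b
  withRow₀ v M (suc a) b = M (suc a) b

  det-addToRow₀ : ∀ n (M N : Mat (suc n)) (r : Fin n) α →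
    (∀ b → N zero b ≈ M zero b + α * M (suc r) b) → (∀ a b → N (suc a) b ≈ M (suc a) b) →
    det (suc n) N ≈ det (suc n) M
  det-addToRow₀ n M N r α row₀≈ rest≈ = begin
      det (suc n) N
    ≈⟨ det-linearInRow (suc n) zero N U M α (λ b → trans (row₀≈ b) (+-comm _ _)) belowU belowM ⟩
      α * det (suc n) U + det (suc n) M
    ≈⟨ +-congʳ (trans (*-congˡ (det-row₀≈row⇒≈0 n U r (λ _ → refl))) (zeroʳ α)) ⟩
      0# + det (suc n) M
    ≈⟨ +-identityˡ _ ⟩
      det (suc n) M ∎
    where
    U = withRow₀ (M (suc r)) M
    belowU : ∀ a b → a ≢ zero → N a b ≈ U a b
    belowU zero    b 0≢0 = ⊥-elim (0≢0 ≡.refl)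
    belowU (suc a) b _   = rest≈ a b
    belowM : ∀ a b → a ≢ zero → N a b ≈ M a b
    belowM zero    b 0≢0 = ⊥-elim (0≢0 ≡.refl)
    belowM (suc a) b _   = rest≈ a b

  replaceRow : ∀ {n} → Mat n → Fin n → (Fin n → Carrier) → Mat n
  replaceRow M r v a b with a Fin.≟ r
  ... | yes _ = v b
  ... | no  _ = M a b

  replaceRow-≡ : ∀ {n} (M : Mat n) r v b → replaceRow M r v r b ≡ v b
  replaceRow-≡ M r v b with r Fin.≟ r
  ... | yes _  = ≡.refl
  ... | no r≢r = ⊥-elim (r≢r ≡.refl)

  replaceRow-≢ : ∀ {n} (M : Mat n) r v a b → a ≢ r → replaceRow M r v a b ≡ M a b
  replaceRow-≢ M r v a b a≢r with a Fin.≟ r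
  ... | yes a≡r = ⊥-elim (a≢r a≡r)
  ... | no  _   = ≡.refl

  det-addRow₀To : ∀ n (M N : Mat (suc n)) (r : Fin n) α →
    (∀ b → N (suc r) b ≈ M (suc r) b + α * M zero b) → (∀ a b → a ≢ suc r → N a b ≈ M a b) →
    det (suc n) N ≈ det (suc n) M
  det-addRow₀To n M N r α row≈ rest≈ = begin
      det (suc n) N
    ≈⟨ det-linearInRow (suc n) (suc r) N U M α
         (λ b → trans (row≈ b) (trans (+-comm _ _) (+-congʳ (*-congˡ (reflexive (≡.sym (replaceRow-≡ M (suc r) (M zero) b)))))))
         (λ a b a≢r → trans (rest≈ a b a≢r) (reflexive (≡.sym (replaceRow-≢ M (suc r) (M zero) a b a≢r))))
         rest≈ ⟩
      α * det (suc n) U + det (suc n) M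
    ≈⟨ +-congʳ (trans (*-congˡ (det-row₀≈row⇒≈0 n U r row₀≈row)) (zeroʳ α)) ⟩
      0# + det (suc n) M
    ≈⟨ +-identityˡ _ ⟩
      det (suc n) M ∎
    where
    U = replaceRow M (suc r) (M zero)
    row₀≈row : ∀ b → U zero b ≈ U (suc r) b
    row₀≈row b = reflexive (≡.trans (replaceRow-≢ M (suc r) (M zero) zero b λ ()) (≡.sym (replaceRow-≡ M (suc r) (M zero) b)))

  addRow₀Multiples : ∀ {n} → Mat (suc n) → (Fin n → Carrier) → Mat (suc n)
  addRow₀Multiples M c zero    b = M zero b
  addRow₀Multiples M c (suc a) b = M (suc a) b + c a * M zero b

  addRow₀Multiples-cong : ∀ {n} (M : Mat (suc n)) {c d : Fin n → Carrier} → (∀ a → c a ≈ d a) →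
    ∀ a b → addRow₀Multiples M c a b ≈ addRow₀Multiples M d a b
  addRow₀Multiples-cong M c≈d zero    b = refl
  addRow₀Multiples-cong M c≈d (suc a) b = +-congˡ (*-congʳ (c≈d a))

  restrictBelow : ∀ {n} → ℕ → (Fin n → Carrier) → Fin n → Carrier
  restrictBelow k c a with toℕ a ℕ.<? k
  ... | yes _ = c a
  ... | no  _ = 0#

  restrictBelow-< : ∀ {n} k (c : Fin n → Carrier) a → toℕ a ℕ.< k → restrictBelow k c a ≡ c a
  restrictBelow-< k c a a<k with toℕ a ℕ.<? k
  ... | yes _   = ≡.refl
  ... | no  a≮k = ⊥-elim (a≮k a<k)

  restrictBelow-≮ : ∀ {n} k (c : Fin n → Carrier) a → ¬ toℕ a ℕ.< k → restrictBelow k c a ≡ 0#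
  restrictBelow-≮ k c a a≮k with toℕ a ℕ.<? k
  ... | yes a<k = ⊥-elim (a≮k a<k)
  ... | no  _   = ≡.refl

  restrictBelow-suc : ∀ {n} k (c : Fin n → Carrier) a → toℕ a ≢ k → restrictBelow (suc k) c a ≡ restrictBelow k c a
  restrictBelow-suc k c a a≢k with toℕ a ℕ.<? k
  ... | yes a<k = restrictBelow-< (suc k) c a (ℕ.m≤n⇒m≤1+n a<k)
  ... | no  a≮k = restrictBelow-≮ (suc k) c a (λ a<1+k → a≮k (ℕ.≤∧≢⇒< (ℕ.≤-pred a<1+k) a≢k))

  det-addRow₀Multiples-restrictBelow : ∀ n (M : Mat (suc n)) c k →
    det (suc n) (addRow₀Multiples M (restrictBelow k c)) ≈ det (suc n) M
  det-addRow₀Multiples-restrictBelow n M c zero = det-cong (suc n) unchanged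
    where
    unchanged : ∀ a b → addRow₀Multiples M (restrictBelow zero c) a b ≈ M a b
    unchanged zero    b = refl
    unchanged (suc a) b = trans (+-congˡ (trans (*-congʳ (reflexive (restrictBelow-≮ zero c a λ ()))) (zeroˡ _))) (+-identityʳ _)
  det-addRow₀Multiples-restrictBelow n M c (suc k) with k ℕ.<? n
  ... | no k≮n = trans
    (det-cong (suc n) (addRow₀Multiples-cong M (λ a → reflexive (restrictBelow-suc k c a
      (λ a≡k → k≮n (≡.subst (ℕ._< n) a≡k (Fin.toℕ<n a)))))))
    (det-addRow₀Multiples-restrictBelow n M c k)
  ... | yes k<n = trans
    (det-addRow₀To n (addRow₀Multiples M (restrictBelow k c)) _ r (c r) newRow otherRows)
    (det-addRow₀Multiples-restrictBelow n M c k)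
    where
    r = Fin.fromℕ< k<n
    r≡k : toℕ r ≡ k
    r≡k = Fin.toℕ-fromℕ< k<n
    newRow : ∀ b → addRow₀Multiples M (restrictBelow (suc k) c) (suc r) b
                   ≈ addRow₀Multiples M (restrictBelow k c) (suc r) b + c r * M zero b
    newRow b = begin
        M (suc r) b + restrictBelow (suc k) c r * M zero b
      ≈⟨ +-congˡ (*-congʳ (reflexive (restrictBelow-< (suc k) c r (ℕ.s≤s (ℕ.≤-reflexive r≡k))))) ⟩
        M (suc r) b + c r * M zero b
      ≈⟨ +-congʳ (trans (+-congˡ (trans (*-congʳ (reflexive (restrictBelow-≮ k c r (ℕ.<-irrefl r≡k)))) (zeroˡ _)))
                        (+-identityʳ _)) ⟨
        (M (suc r) b + restrictBelow k c r * M zero b) + c r * M zero b ∎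
    otherRows : ∀ a b → a ≢ suc r →
      addRow₀Multiples M (restrictBelow (suc k) c) a b ≈ addRow₀Multiples M (restrictBelow k c) a b
    otherRows zero    b _      = refl
    otherRows (suc a) b a≢1+r = +-congˡ (*-congʳ (reflexive (restrictBelow-suc k c a
      (λ a≡k → a≢1+r (≡.cong suc (Fin.toℕ-injective (≡.trans a≡k (≡.sym r≡k))))))))

  det-addRow₀Multiples : ∀ n (M : Mat (suc n)) c → det (suc n) (addRow₀Multiples M c) ≈ det (suc n) M
  det-addRow₀Multiples n M c = trans
    (det-cong (suc n) (addRow₀Multiples-cong M (λ a → reflexive (≡.sym (restrictBelow-< n c a (Fin.toℕ<n a))))))
    (det-addRow₀Multiples-restrictBelow n M c n)

  det-addToEntry₀₀ : ∀ n (M N : Mat (suc n)) α → N zero zero ≈ α + M zero zero →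
    (∀ b → N zero (suc b) ≈ M zero (suc b)) → (∀ a b → N (suc a) b ≈ M (suc a) b) →
    det (suc n) N ≈ α * det n (minor M zero) + det (suc n) M
  det-addToEntry₀₀ n M N α entry₀₀ row₀ rest = begin
      (1# * N zero zero) * det n (minor N zero) + ΣFin n (λ j → expansionTerm N (suc j))
    ≈⟨ +-cong (*-cong (trans (*-identityˡ _) entry₀₀) (det-cong n (λ a b → rest a (suc b))))
              (ΣFin-cong n (λ j → *-cong (*-congˡ {altSign (suc j)} (row₀ j))
                                         (det-cong n (λ a b → rest a (punchIn (suc j) b))))) ⟩
      (α + M zero zero) * d + S
    ≈⟨ spread α (M zero zero) d S ⟩
      α * d + (M zero zero * d + S)
    ≈⟨ +-congˡ (+-congʳ (*-congʳ (*-identityˡ _))) ⟨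
      α * d + ((1# * M zero zero) * d + S) ∎
    where
    d = det n (minor M zero)
    S = ΣFin n (λ j → expansionTerm M (suc j))
    spread : ∀ α A d S → (α + A) * d + S ≈ α * d + (A * d + S)
    spread = solve 4 (λ α A d S → (α :+ A) :* d :+ S := α :* d :+ (A :* d :+ S)) refl

idMat-suc : ∀ {N} (a b : Fin N) → idMat (suc a) (suc b) ≡ idMat a b
idMat-suc a b with a Fin.≟ b
... | yes _ = ≡.refl
... | no  _ = ≡.refl

partOf-suc : ∀ {k} m (r : Vec ℕ k) v → partOf (suc m ∷ r) (suc v) ≡ partOf (m ∷ r) v
partOf-suc m r v with splitAt m v
... | inj₁ _ = ≡.refl
... | inj₂ _ = ≡.refl

adjMat-cong : ∀ {k k′} (ns : Vec ℕ k) (ns′ : Vec ℕ k′) u v u′ v′ →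
  (partOf ns u ≡ partOf ns v → partOf ns′ u′ ≡ partOf ns′ v′) →
  (partOf ns′ u′ ≡ partOf ns′ v′ → partOf ns u ≡ partOf ns v) →
  adjMat ns u v ≡ adjMat ns′ u′ v′
adjMat-cong ns ns′ u v u′ v′ to from with partOf ns u Fin.≟ partOf ns v | partOf ns′ u′ Fin.≟ partOf ns′ v′
... | yes _    | yes _     = ≡.refl
... | no  _    | no  _     = ≡.refl
... | yes same | no  diff′ = ⊥-elim (diff′ (to same))
... | no  diff | yes same′ = ⊥-elim (diff (from same′))

adjMat-suc : ∀ {k} m (r : Vec ℕ k) a b → adjMat (suc m ∷ r) (suc a) (suc b) ≡ adjMat (m ∷ r) a b
adjMat-suc m r a b = adjMat-cong (suc m ∷ r) (m ∷ r) (suc a) (suc b) a b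
  (λ e → ≡.trans (≡.sym (partOf-suc m r a)) (≡.trans e (partOf-suc m r b)))
  (λ e → ≡.trans (partOf-suc m r a) (≡.trans e (≡.sym (partOf-suc m r b))))

adjMat-zero : ∀ {k} (r : Vec ℕ k) a b → adjMat (0 ∷ r) a b ≡ adjMat r a b
adjMat-zero r a b with partOf r a Fin.≟ partOf r b
... | yes _ = ≡.refl
... | no  _ = ≡.refl

module PartMatrix {c ℓ} (R : CommutativeRing c ℓ) where
  open CommutativeRing R hiding (zero)
  open RingDefs R
  open IntegerEmbedding R
  open Determinant R
  open import Algebra.Properties.Ring ring using (-1*x≈-x)
  open import Relation.Binary.Reasoning.Setoid setoid

  -- y I + t J - 2 B, where B u v = 1 exactly when u and v lie in the same part;
  -- λ I - S(G) is the case y = λ + 1, t = 1.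
  partMatrix : ∀ {k} (ns : Vec ℕ k) (y t : Carrier) → Mat (sum ns)
  partMatrix ns y t u v = (y * ℤ→R (idMat u v) + t) - ℕ→R 2 * ℤ→R (+ 1 ℤ.- adjMat ns u v)

  partDet : ∀ {k} (ns : Vec ℕ k) (y t : Carrier) → Carrier
  partDet ns y t = det (sum ns) (partMatrix ns y t)

  partMatrix-suc : ∀ {k} m (r : Vec ℕ k) y t a b →
    partMatrix (suc m ∷ r) y t (suc a) (suc b) ≈ partMatrix (m ∷ r) y t a b
  partMatrix-suc m r y t a b rewrite idMat-suc a b | adjMat-suc m r a b = refl

  partMatrix-zero : ∀ {k} (r : Vec ℕ k) y t a b → partMatrix (0 ∷ r) y t a b ≈ partMatrix r y t a b
  partMatrix-zero r y t a b rewrite adjMat-zero r a b = refl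

  charMat≈partMatrix : ∀ {k} (ns : Vec ℕ k) x u v → charMat ns x u v ≈ partMatrix ns (x + 1#) 1# u v
  charMat≈partMatrix ns x u v = begin
      x * δ - ℤ→R (seidel ns u v)
    ≈⟨ +-congˡ (-‿cong (trans (ℤ→R-sub (+ 1 ℤ.- idMat u v) (+ 2 ℤ.* adjMat ns u v))
                              (+-cong (ℤ→R-sub (+ 1) (idMat u v)) (-‿cong (ℤ→R-* (+ 2) (adjMat ns u v)))))) ⟩
      x * δ - ((ℕ→R 1 - δ) - ℕ→R 2 * A)
    ≈⟨ solve 3 (λ x δ A → x :* δ :- ((con (+ 1) :- δ) :- con (+ 2) :* A)
                        := ((x :+ con (+ 1)) :* δ :+ con (+ 1)) :- con (+ 2) :* (con (+ 1) :- A)) refl x δ A ⟩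
      ((x + ℕ→R 1) * δ + ℕ→R 1) - ℕ→R 2 * (ℕ→R 1 - A)
    ≈⟨ +-cong (+-cong (*-congʳ (+-congˡ (+-identityʳ 1#))) (+-identityʳ 1#))
              (-‿cong (*-congˡ (sym (ℤ→R-sub (+ 1) (adjMat ns u v))))) ⟩
      partMatrix ns (x + 1#) 1# u v ∎
    where
    δ = ℤ→R (idMat u v)
    A = ℤ→R (adjMat ns u v)

  partMatrix-sameRowPart : ∀ {k} (ns : Vec ℕ k) y t u u′ v → partOf ns u ≡ partOf ns u′ →
    partMatrix ns y t u v - partMatrix ns y t u′ v ≈ y * (ℤ→R (idMat u v) - ℤ→R (idMat u′ v))
  partMatrix-sameRowPart ns y t u u′ v same
    rewrite adjMat-cong ns ns u v u′ v (≡.trans (≡.sym same)) (≡.trans same) = difference _ _ _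
    where
    difference : ∀ d d′ s → ((y * d + t) - ℕ→R 2 * s) - ((y * d′ + t) - ℕ→R 2 * s) ≈ y * (d - d′)
    difference = solve 5 (λ y t d d′ s →
      ((y :* d :+ t) :- con (+ 2) :* s) :- ((y :* d′ :+ t) :- con (+ 2) :* s) := y :* (d :- d′)) refl y t

  partMatrix-sameColPart : ∀ {k} (ns : Vec ℕ k) y t u v v′ → partOf ns v ≡ partOf ns v′ → idMat u v ≡ idMat u v′ →
    partMatrix ns y t u v ≈ partMatrix ns y t u v′
  partMatrix-sameColPart ns y t u v v′ same idMat≡
    rewrite idMat≡ | adjMat-cong ns ns u v u v′ (λ e → ≡.trans e same) (λ e → ≡.trans e (≡.sym same)) = refl

  partDet-emptyPart : ∀ {k} (r : Vec ℕ k) y t → partDet (0 ∷ r) y t ≈ partDet r y t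
  partDet-emptyPart r y t = det-cong (sum r) (partMatrix-zero r y t)

  partMatrix-tail : ∀ {k} (r : Vec ℕ k) y t a b → partMatrix (1 ∷ r) y t (suc a) (suc b) ≈ partMatrix r y t a b
  partMatrix-tail r y t a b = trans (partMatrix-suc 0 r y t a b) (partMatrix-zero r y t a b)

  -- Subtracting t times the first row from the others clears the first column.
  det-partMatrix-onesRow : ∀ {k} (r : Vec ℕ k) y t →
    det (suc (sum r)) (withRow₀ (λ _ → 1#) (partMatrix (1 ∷ r) y t)) ≈ partDet r y 0#
  det-partMatrix-onesRow r y t = begin
      det (suc n) W
    ≈⟨ det-addRow₀Multiples n W (λ _ → - t) ⟨
      det (suc n) W′
    ≈⟨ det-col₀-supportedOn₀ n W′ (λ a → trans (+-congˡ (*-identityʳ (- t))) cleared) ⟩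
      1# * det n (minor W′ zero)
    ≈⟨ *-identityˡ _ ⟩
      det n (minor W′ zero)
    ≈⟨ det-cong n (λ a b → trans (+-cong (partMatrix-tail r y t a b) (*-identityʳ (- t))) (dropT _ _)) ⟩
      partDet r y 0# ∎
    where
    n = sum r
    W = withRow₀ (λ _ → 1#) (partMatrix (1 ∷ r) y t)
    W′ = addRow₀Multiples W (λ _ → - t)
    cleared : (y * 0# + t) - ℕ→R 2 * 0# + - t ≈ 0#
    cleared = solve 2 (λ y t → ((y :* con (+ 0) :+ t) :- con (+ 2) :* con (+ 0)) :+ (:- t) := con (+ 0)) refl y t
    dropT : ∀ d s → ((y * d + t) - ℕ→R 2 * s) + - t ≈ (y * d + 0#) - ℕ→R 2 * s
    dropT = solve 4 (λ y t d s → ((y :* d :+ t) :- con (+ 2) :* s) :+ (:- t) := (y :* d :+ con (+ 0)) :- con (+ 2) :* s) refl y t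

  partDet-singletonPart : ∀ {k} (r : Vec ℕ k) y t →
    partDet (1 ∷ r) y t ≈ (y - ℕ→R 2) * partDet r y t + t * partDet r y 0#
  partDet-singletonPart r y t = begin
      det (suc n) E
    ≈⟨ det-addToEntry₀₀ n W E (y - ℕ→R 2) entry₀₀ (λ _ → entry₀ₛ) (λ _ _ → refl) ⟩
      (y - ℕ→R 2) * det n (minor W zero) + det (suc n) W
    ≈⟨ +-cong (*-congˡ (det-cong n (partMatrix-tail r y t)))
              (det-scaleRow₀ n (withRow₀ (λ _ → 1#) E) W t (λ _ → sym (*-identityʳ t)) (λ _ _ → refl)) ⟩
      (y - ℕ→R 2) * partDet r y t + t * det (suc n) (withRow₀ (λ _ → 1#) E)
    ≈⟨ +-congˡ (*-congˡ (det-partMatrix-onesRow r y t)) ⟩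
      (y - ℕ→R 2) * partDet r y t + t * partDet r y 0# ∎
    where
    n = sum r
    E = partMatrix (1 ∷ r) y t
    W = withRow₀ (λ _ → t) E
    entry₀₀ : E zero zero ≈ (y - ℕ→R 2) + t
    entry₀₀ = solve 2 (λ y t → (y :* con (+ 1) :+ t) :- con (+ 2) :* con (+ 1) := (y :- con (+ 2)) :+ t) refl y t
    entry₀ₛ : (y * 0# + t) - ℕ→R 2 * 0# ≈ t
    entry₀ₛ = solve 2 (λ y t → (y :* con (+ 0) :+ t) :- con (+ 2) :* con (+ 0) := t) refl y t

  det-partMatrix-withoutRow₀Col₁ : ∀ {k} m (r : Vec ℕ k) y t →
    det (suc (m ℕ.+ sum r)) (minor (partMatrix (suc (suc m) ∷ r) y t) (suc zero))
      ≈ - y * partDet (m ∷ r) y t + partDet (suc m ∷ r) y t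
  det-partMatrix-withoutRow₀Col₁ m r y t = trans
    (det-addToEntry₀₀ (m ℕ.+ sum r) E₁ (minor E (suc zero)) (- y)
      entry₁₀ (λ b → partMatrix-suc (suc m) r y t zero (suc b)) rows)
    (+-congʳ (*-congˡ (det-cong (m ℕ.+ sum r) (partMatrix-suc m r y t))))
    where
    ns = suc (suc m) ∷ r
    E = partMatrix ns y t
    E₁ = partMatrix (suc m ∷ r) y t
    entry₁₀ : E (suc zero) zero ≈ - y + E₁ zero zero
    entry₁₀ = solve 2 (λ y t →
      (y :* con (+ 0) :+ t) :- con (+ 2) :* con (+ 1) := (:- y) :+ ((y :* con (+ 1) :+ t) :- con (+ 2) :* con (+ 1))) refl y t
    rows : ∀ a b → E (suc (suc a)) (punchIn (suc zero) b) ≈ E₁ (suc a) b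
    rows a zero    = trans (partMatrix-sameColPart ns y t (suc (suc a)) zero (suc zero) ≡.refl ≡.refl)
                           (partMatrix-suc (suc m) r y t (suc a) zero)
    rows a (suc b) = partMatrix-suc (suc m) r y t (suc a) (suc b)

  -- Subtracting row 1 from row 0 (both in the first part) leaves y e₀ - y e₁ in row 0.
  partDet-growPart : ∀ {k} m (r : Vec ℕ k) y t →
    partDet (suc (suc m) ∷ r) y t ≈ ℕ→R 2 * y * partDet (suc m ∷ r) y t - y * y * partDet (m ∷ r) y t
  partDet-growPart m r y t = begin
      det (suc (suc n)) E
    ≈⟨ det-addToRow₀ (suc n) E E′ zero (- 1#) (λ b → +-congˡ (sym (-1*x≈-x _))) (λ _ _ → refl) ⟨
      det (suc (suc n)) E′
    ≈⟨ det-row₀-supportedOn₀₁ n E′ (λ b → trans (row₀ (suc (suc b))) (vanish y)) ⟩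
      E′ zero zero * det (suc n) (minor E′ zero) - E′ zero (suc zero) * det (suc n) (minor E′ (suc zero))
    ≈⟨ +-cong (*-cong (row₀ zero) (det-cong (suc n) (partMatrix-suc (suc m) r y t)))
              (-‿cong (*-cong (row₀ (suc zero)) (det-partMatrix-withoutRow₀Col₁ m r y t))) ⟩
      y * (1# + 0# - 0#) * D₁ - y * (0# - (1# + 0#)) * (- y * D₀ + D₁)
    ≈⟨ recurrence y D₀ D₁ ⟩
      ℕ→R 2 * y * D₁ - y * y * D₀ ∎
    where
    n = m ℕ.+ sum r
    ns = suc (suc m) ∷ r
    E = partMatrix ns y t
    D₀ = partDet (m ∷ r) y t
    D₁ = partDet (suc m ∷ r) y t
    E′ = withRow₀ (λ b → E zero b - E (suc zero) b) E
    row₀ : ∀ b → E′ zero b ≈ y * (ℤ→R (idMat zero b) - ℤ→R (idMat (suc zero) b))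
    row₀ b = partMatrix-sameRowPart ns y t zero (suc zero) b ≡.refl
    vanish : ∀ y → y * (0# - 0#) ≈ 0#
    vanish = solve 1 (λ y → y :* (con (+ 0) :- con (+ 0)) := con (+ 0)) refl
    recurrence : ∀ y D₀ D₁ →
      y * (1# + 0# - 0#) * D₁ - y * (0# - (1# + 0#)) * (- y * D₀ + D₁) ≈ ℕ→R 2 * y * D₁ - y * y * D₀
    recurrence = solve 3 (λ y D₀ D₁ →
      y :* (con (+ 1) :- con (+ 0)) :* D₁ :- y :* (con (+ 0) :- con (+ 1)) :* ((:- y) :* D₀ :+ D₁)
        := con (+ 2) :* y :* D₁ :- y :* y :* D₀) refl

  partDet-firstPart : ∀ {k} m (r : Vec ℕ k) y t → partDet (suc m ∷ r) y t ≈
    pow y m * ((y - ℕ→R 2 * ℕ→R (suc m)) * partDet r y t + t * ℕ→R (suc m) * partDet r y 0#)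
  partDet-firstPart zero r y t = begin
      partDet (1 ∷ r) y t                             ≈⟨ partDet-singletonPart r y t ⟩
      (y - ℕ→R 2) * A + t * B                         ≈⟨ base y t A B ⟩
      (y - ℕ→R 2 * ℕ→R 1) * A + t * ℕ→R 1 * B         ≈⟨ *-identityˡ _ ⟨
      1# * ((y - ℕ→R 2 * ℕ→R 1) * A + t * ℕ→R 1 * B)  ∎
    where
    A = partDet r y t
    B = partDet r y 0#
    base : ∀ y t A B → (y - ℕ→R 2) * A + t * B ≈ (y - ℕ→R 2 * ℕ→R 1) * A + t * ℕ→R 1 * B
    base = solve 4 (λ y t A B →
      (y :- con (+ 2)) :* A :+ t :* B := (y :- con (+ 2) :* con (+ 1)) :* A :+ t :* con (+ 1) :* B) refl
  partDet-firstPart (suc zero) r y t = begin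
      partDet (2 ∷ r) y t
    ≈⟨ partDet-growPart 0 r y t ⟩
      ℕ→R 2 * y * partDet (1 ∷ r) y t - y * y * partDet (0 ∷ r) y t
    ≈⟨ +-cong (*-congˡ (trans (partDet-firstPart zero r y t) (*-identityˡ _)))
              (-‿cong (*-congˡ (partDet-emptyPart r y t))) ⟩
      ℕ→R 2 * y * ((y - ℕ→R 2 * ℕ→R 1) * A + t * ℕ→R 1 * B) - y * y * A
    ≈⟨ step y t A B ⟩
      y * ((y - ℕ→R 2 * ℕ→R 2) * A + t * ℕ→R 2 * B)
    ≈⟨ *-congʳ (*-identityʳ y) ⟨
      (y * 1#) * ((y - ℕ→R 2 * ℕ→R 2) * A + t * ℕ→R 2 * B) ∎
    where
    A = partDet r y t
    B = partDet r y 0#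
    step : ∀ y t A B → ℕ→R 2 * y * ((y - ℕ→R 2 * ℕ→R 1) * A + t * ℕ→R 1 * B) - y * y * A
                       ≈ y * ((y - ℕ→R 2 * ℕ→R 2) * A + t * ℕ→R 2 * B)
    step = solve 4 (λ y t A B →
      con (+ 2) :* y :* ((y :- con (+ 2) :* con (+ 1)) :* A :+ t :* con (+ 1) :* B) :- y :* y :* A
        := y :* ((y :- con (+ 2) :* con (+ 2)) :* A :+ t :* con (+ 2) :* B)) refl
  partDet-firstPart (suc (suc m)) r y t = begin
      partDet (suc (suc (suc m)) ∷ r) y t
    ≈⟨ partDet-growPart (suc m) r y t ⟩
      ℕ→R 2 * y * partDet (suc (suc m) ∷ r) y t - y * y * partDet (suc m ∷ r) y t
    ≈⟨ +-cong (*-congˡ (partDet-firstPart (suc m) r y t)) (-‿cong (*-congˡ (partDet-firstPart m r y t))) ⟩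
      ℕ→R 2 * y * ((y * P) * ((y - ℕ→R 2 * (1# + a)) * A + t * (1# + a) * B))
        - y * y * (P * ((y - ℕ→R 2 * a) * A + t * a * B))
    ≈⟨ step y t A B P a 1# ⟩
      (y * (y * P)) * ((y - ℕ→R 2 * (1# + (1# + a))) * A + t * (1# + (1# + a)) * B) ∎
    where
    A = partDet r y t
    B = partDet r y 0#
    P = pow y m
    a = ℕ→R (suc m)
    -- 1# enters as a variable o, since the solver's constant 1 is 1# + 0#.
    step : ∀ y t A B P a o →
      ℕ→R 2 * y * ((y * P) * ((y - ℕ→R 2 * (o + a)) * A + t * (o + a) * B)) - y * y * (P * ((y - ℕ→R 2 * a) * A + t * a * B))
        ≈ (y * (y * P)) * ((y - ℕ→R 2 * (o + (o + a))) * A + t * (o + (o + a)) * B)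
    step = solve 7 (λ y t A B P a o →
      con (+ 2) :* y :* ((y :* P) :* ((y :- con (+ 2) :* (o :+ a)) :* A :+ t :* (o :+ a) :* B))
        :- y :* y :* (P :* ((y :- con (+ 2) :* a) :* A :+ t :* a :* B))
        := (y :* (y :* P)) :* ((y :- con (+ 2) :* (o :+ (o :+ a))) :* A :+ t :* (o :+ (o :+ a)) :* B)) refl

σ-zero : ∀ {k} (ns : Vec ℕ k) → σ ns 0 ≡ 1
σ-zero []       = ≡.refl
σ-zero (_ ∷ _)  = ≡.refl

σ-one : ∀ {k} (ns : Vec ℕ k) → σ ns 1 ≡ sum ns
σ-one []       = ≡.refl
σ-one (n ∷ ns) rewrite σ-one ns | σ-zero ns | ℕ.*-identityʳ n = ℕ.+-comm (sum ns) n

σ-vanishes : ∀ {k} (ns : Vec ℕ k) j → k ℕ.< j → σ ns j ≡ 0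
σ-vanishes []       (suc j) _       = ≡.refl
σ-vanishes (n ∷ ns) (suc j) (s≤s k<j)
  rewrite σ-vanishes ns (suc j) (ℕ.m≤n⇒m≤1+n k<j) | σ-vanishes ns j k<j = ℕ.*-zeroʳ n

length≤sum : ∀ {k} (ns : Vec ℕ k) → All (1 ≤_) ns → k ≤ sum ns
length≤sum []       []         = z≤n
length≤sum (n ∷ ns) (1≤n ∷ ps) = ℕ.+-mono-≤ 1≤n (length≤sum ns ps)

module Sums {c ℓ} (R : CommutativeRing c ℓ) where
  open CommutativeRing R hiding (zero)
  open RingDefs R
  open IntegerEmbedding R
  open import Algebra.Properties.Semiring.Exp semiring using (_^_; ^-congˡ; ^-homo-*)
  open import Algebra.Properties.Semiring.Mult semiring using (_×_; ×-congʳ; ×-assoc-*)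
  import Algebra.Properties.CommutativeSemiring.Binomial commutativeSemiring as Binomial
  import Algebra.Properties.Monoid.Sum +-monoid as MonoidSum
  open import Relation.Binary.Reasoning.Setoid setoid

  ΣR-cong : ∀ n {f g : ℕ → Carrier} → (∀ i → i ≤ n → f i ≈ g i) → ΣR n f ≈ ΣR n g
  ΣR-cong zero    f≈g = f≈g 0 z≤n
  ΣR-cong (suc n) f≈g = +-cong (ΣR-cong n (λ i i≤n → f≈g i (ℕ.m≤n⇒m≤1+n i≤n))) (f≈g (suc n) ℕ.≤-refl)

  ΣR-+ : ∀ n (f g : ℕ → Carrier) → ΣR n (λ i → f i + g i) ≈ ΣR n f + ΣR n g
  ΣR-+ zero    f g = refl
  ΣR-+ (suc n) f g = trans (+-congʳ (ΣR-+ n f g)) (interchange _ _ _ _)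
    where
    interchange : ∀ a b c d → (a + b) + (c + d) ≈ (a + c) + (b + d)
    interchange = solve 4 (λ a b c d → (a :+ b) :+ (c :+ d) := (a :+ c) :+ (b :+ d)) refl

  ΣR-*ˡ : ∀ n a (f : ℕ → Carrier) → ΣR n (λ i → a * f i) ≈ a * ΣR n f
  ΣR-*ˡ zero    a f = refl
  ΣR-*ˡ (suc n) a f = trans (+-congʳ (ΣR-*ˡ n a f)) (sym (distribˡ _ _ _))

  ΣR-*ʳ : ∀ n a (f : ℕ → Carrier) → ΣR n (λ i → f i * a) ≈ ΣR n f * a
  ΣR-*ʳ zero    a f = refl
  ΣR-*ʳ (suc n) a f = trans (+-congʳ (ΣR-*ʳ n a f)) (sym (distribʳ _ _ _))

  ΣR-head : ∀ n (f : ℕ → Carrier) → ΣR (suc n) f ≈ f 0 + ΣR n (f ∘ suc)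
  ΣR-head zero    f = refl
  ΣR-head (suc n) f = trans (+-congʳ (ΣR-head n f)) (+-assoc _ _ _)

  ΣR-triangle : ∀ k (h : ℕ → ℕ → Carrier) →
    ΣR k (λ m → ΣR m (λ i → h i m)) ≈ ΣR k (λ i → ΣR (k ∸ i) (λ p → h i (i ℕ.+ p)))
  ΣR-triangle zero    h = refl
  ΣR-triangle (suc k) h = begin
      ΣR k (λ m → ΣR m (λ i → h i m)) + (ΣR k (λ i → h i (suc k)) + h (suc k) (suc k))
    ≈⟨ +-congʳ (ΣR-triangle k h) ⟩
      ΣR k (λ i → ΣR (k ∸ i) (λ p → h i (i ℕ.+ p))) + (ΣR k (λ i → h i (suc k)) + h (suc k) (suc k))
    ≈⟨ +-assoc _ _ _ ⟨
      (ΣR k (λ i → ΣR (k ∸ i) (λ p → h i (i ℕ.+ p))) + ΣR k (λ i → h i (suc k))) + h (suc k) (suc k)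
    ≈⟨ +-cong (sym (ΣR-+ k _ _)) lastRow ⟩
      ΣR k (λ i → ΣR (k ∸ i) (λ p → h i (i ℕ.+ p)) + h i (suc k)) + ΣR (suc k ∸ suc k) (λ p → h (suc k) (suc k ℕ.+ p))
    ≈⟨ +-congʳ (ΣR-cong k extendRow) ⟩
      ΣR k (λ i → ΣR (suc k ∸ i) (λ p → h i (i ℕ.+ p))) + ΣR (suc k ∸ suc k) (λ p → h (suc k) (suc k ℕ.+ p))
    ∎
    where
    lastRow : h (suc k) (suc k) ≈ ΣR (suc k ∸ suc k) (λ p → h (suc k) (suc k ℕ.+ p))
    lastRow rewrite ℕ.n∸n≡0 (suc k) | ℕ.+-identityʳ k = refl
    extendRow : ∀ i → i ≤ k → ΣR (k ∸ i) (λ p → h i (i ℕ.+ p)) + h i (suc k) ≈ ΣR (suc k ∸ i) (λ p → h i (i ℕ.+ p))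
    extendRow i i≤k rewrite ℕ.+-∸-assoc 1 i≤k | ℕ.+-suc i (k ∸ i) | ℕ.m+[n∸m]≡n i≤k = refl

  ΣR≈sum : ∀ n (f : ℕ → Carrier) → ΣR n f ≈ MonoidSum.sum {suc n} (f ∘ toℕ)
  ΣR≈sum zero    f = sym (+-identityʳ _)
  ΣR≈sum (suc n) f = trans (ΣR-head n f) (+-congˡ (ΣR≈sum n (f ∘ suc)))

  pow≡^ : ∀ z n → pow z n ≡ z ^ n
  pow≡^ z zero    = ≡.refl
  pow≡^ z (suc n) = ≡.cong (z *_) (pow≡^ z n)

  pow-+ : ∀ z m n → pow z (m ℕ.+ n) ≈ pow z m * pow z n
  pow-+ z m n rewrite pow≡^ z (m ℕ.+ n) | pow≡^ z m | pow≡^ z n = ^-homo-* z m n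

  binomial : ∀ x n → pow (x + 1#) n ≈ ΣR n (λ p → ℕ→R (n C p) * pow x (n ∸ p))
  binomial x n = begin
      pow (x + 1#) n                                            ≡⟨ pow≡^ (x + 1#) n ⟩
      (x + 1#) ^ n                                              ≈⟨ ^-congˡ n (+-comm x 1#) ⟩
      (1# + x) ^ n                                              ≈⟨ Binomial.theorem n 1# x ⟩
      Binomial.binomialExpansion 1# x n                         ≈⟨ MonoidSum.sum-cong-≋ {suc n} (term≈ ∘ toℕ) ⟩
      MonoidSum.sum {suc n} (λ k → ℕ→R (n C toℕ k) * pow x (n ∸ toℕ k)) ≈⟨ ΣR≈sum n _ ⟨
      ΣR n (λ p → ℕ→R (n C p) * pow x (n ∸ p))                  ∎
    where
    one^ : ∀ j → 1# ^ j ≈ 1#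
    one^ zero    = refl
    one^ (suc j) = trans (*-identityˡ _) (one^ j)
    term≈ : ∀ j → (n C j) × (1# ^ j * x ^ (n ∸ j)) ≈ ℕ→R (n C j) * pow x (n ∸ j)
    term≈ j = begin
      (n C j) × (1# ^ j * x ^ (n ∸ j))   ≈⟨ ×-congʳ (n C j) (trans (*-congʳ (one^ j)) (*-identityˡ _)) ⟩
      (n C j) × (x ^ (n ∸ j))            ≈⟨ ×-congʳ (n C j) (*-identityˡ _) ⟨
      (n C j) × (1# * x ^ (n ∸ j))       ≈⟨ ×-assoc-* (n C j) 1# _ ⟨
      ((n C j) × 1#) * x ^ (n ∸ j)       ≡⟨ ≡.cong₂ _*_ (≡.sym (ℕ→R≡×1# (n C j))) (≡.sym (pow≡^ x (n ∸ j))) ⟩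
      ℕ→R (n C j) * pow x (n ∸ j)        ∎

module ClosedForm {c ℓ} (R : CommutativeRing c ℓ) where
  open CommutativeRing R hiding (zero)
  open RingDefs R
  open IntegerEmbedding R
  open PartMatrix R
  open Sums R
  open import Relation.Binary.Reasoning.Setoid setoid

  symPoly : ∀ {k} → (ℕ → Carrier) → Vec ℕ k → Carrier → Carrier
  symPoly {k} w ns y = ΣR k (λ i → (w i * ℕ→R (σ ns i)) * pow y (k ∸ i))

  symPoly-cong : ∀ {k} {w w′ : ℕ → Carrier} (ns : Vec ℕ k) y → (∀ i → w i ≈ w′ i) → symPoly w ns y ≈ symPoly w′ ns y
  symPoly-cong {k} ns y w≈w′ = ΣR-cong k (λ i _ → *-congʳ (*-congʳ (w≈w′ i)))

  symPoly-+ : ∀ {k} (u v : ℕ → Carrier) (ns : Vec ℕ k) y →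
    symPoly (λ i → u i + v i) ns y ≈ symPoly u ns y + symPoly v ns y
  symPoly-+ {k} u v ns y = trans (ΣR-cong k (λ i _ → trans (*-congʳ (distribʳ _ _ _)) (distribʳ _ _ _))) (ΣR-+ k _ _)

  symPoly-*ˡ : ∀ {k} α (u : ℕ → Carrier) (ns : Vec ℕ k) y → symPoly (λ i → α * u i) ns y ≈ α * symPoly u ns y
  symPoly-*ˡ {k} α u ns y = trans (ΣR-cong k (λ i _ → trans (*-congʳ (*-assoc _ _ _)) (*-assoc _ _ _))) (ΣR-*ˡ k α _)

  symPoly-[] : ∀ w y → symPoly w [] y ≈ w 0
  symPoly-[] w y = trans (*-identityʳ _) (trans (*-congˡ (+-identityʳ 1#)) (*-identityʳ _))

  -- σᵢ(n ∷ ns) = σᵢ(ns) + n σᵢ₋₁(ns), and σₖ₊₁(ns) = 0.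
  symPoly-∷ : ∀ {k} w n (ns : Vec ℕ k) y → symPoly w (n ∷ ns) y ≈ y * symPoly w ns y + ℕ→R n * symPoly (w ∘ suc) ns y
  symPoly-∷ {k} w n ns y = begin
      ΣR (suc k) G
    ≈⟨ ΣR-head k G ⟩
      G 0 + ΣR k (G ∘ suc)
    ≈⟨ +-cong (*-congʳ (*-congˡ (reflexive (≡.cong ℕ→R (≡.sym (σ-zero ns))))))
              (trans (ΣR-cong k (λ i _ → G-suc i)) (trans (ΣR-+ k _ _) (+-congˡ (ΣR-*ˡ k (ℕ→R n) _)))) ⟩
      F 0 + (ΣR k (F ∘ suc) + ℕ→R n * symPoly (w ∘ suc) ns y)
    ≈⟨ +-assoc _ _ _ ⟨
      (F 0 + ΣR k (F ∘ suc)) + ℕ→R n * symPoly (w ∘ suc) ns y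
    ≈⟨ +-congʳ (ΣR-head k F) ⟨
      (ΣR k F + F (suc k)) + ℕ→R n * symPoly (w ∘ suc) ns y
    ≈⟨ +-congʳ (trans (+-cong (trans (ΣR-cong k (λ i i≤k → F≈ i i≤k)) (ΣR-*ˡ k y _)) F-top) (+-identityʳ _)) ⟩
      y * symPoly w ns y + ℕ→R n * symPoly (w ∘ suc) ns y ∎
    where
    G F : ℕ → Carrier
    G i = (w i * ℕ→R (σ (n ∷ ns) i)) * pow y (suc k ∸ i)
    F i = (w i * ℕ→R (σ ns i)) * pow y (suc k ∸ i)
    G-suc : ∀ i → G (suc i) ≈ F (suc i) + ℕ→R n * ((w (suc i) * ℕ→R (σ ns i)) * pow y (k ∸ i))
    G-suc i = trans (*-congʳ (*-congˡ (trans (ℕ→R-+ (σ ns (suc i)) (n ℕ.* σ ns i)) (+-congˡ (ℕ→R-* n (σ ns i))))))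
      (solve 5 (λ c a b m p → (c :* (a :+ m :* b)) :* p := (c :* a) :* p :+ m :* ((c :* b) :* p)) refl
        (w (suc i)) (ℕ→R (σ ns (suc i))) (ℕ→R (σ ns i)) (ℕ→R n) (pow y (k ∸ i)))
    F≈ : ∀ i → i ≤ k → F i ≈ y * ((w i * ℕ→R (σ ns i)) * pow y (k ∸ i))
    F≈ i i≤k = trans (*-congˡ (reflexive (≡.cong (pow y) (ℕ.+-∸-assoc 1 i≤k))))
      (solve 3 (λ a y p → a :* (y :* p) := y :* (a :* p)) refl _ y _)
    F-top : F (suc k) ≈ 0#
    F-top = trans (*-congʳ (trans (*-congˡ (reflexive (≡.cong ℕ→R (σ-vanishes ns (suc k) ℕ.≤-refl)))) (zeroʳ _))) (zeroˡ _)

  negTwo : Carrier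
  negTwo = - ℕ→R 2

  w₀ w₁ : ℕ → Carrier
  w₀ i       = pow negTwo i
  w₁ zero    = 1#
  w₁ (suc j) = pow negTwo j * (ℕ→R (suc j) - ℕ→R 2)

  w₁-suc : ∀ i → w₁ (suc i) ≈ negTwo * w₁ i + w₀ i
  w₁-suc zero = solve 1 (λ o → o :* (con (+ 1) :- con (+ 2)) := (:- con (+ 2)) :* o :+ o) refl 1#
  w₁-suc (suc j) = trans (*-congˡ (+-congʳ (+-congʳ (sym (+-identityʳ 1#)))))
    (solve 2 (λ P b → ((:- con (+ 2)) :* P) :* ((con (+ 1) :+ b) :- con (+ 2))
                       := (:- con (+ 2)) :* (P :* (b :- con (+ 2))) :+ (:- con (+ 2)) :* P) refl
      (pow negTwo j) (ℕ→R (suc j)))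

  symPoly-w₀-∷ : ∀ {k} n (ns : Vec ℕ k) y →
    symPoly w₀ (n ∷ ns) y ≈ y * symPoly w₀ ns y + ℕ→R n * (negTwo * symPoly w₀ ns y)
  symPoly-w₀-∷ n ns y = trans (symPoly-∷ w₀ n ns y) (+-congˡ (*-congˡ (symPoly-*ˡ negTwo w₀ ns y)))

  symPoly-w₁-∷ : ∀ {k} n (ns : Vec ℕ k) y →
    symPoly w₁ (n ∷ ns) y ≈ y * symPoly w₁ ns y + ℕ→R n * (negTwo * symPoly w₁ ns y + symPoly w₀ ns y)
  symPoly-w₁-∷ n ns y = trans (symPoly-∷ w₁ n ns y) (+-congˡ (*-congˡ (begin
    symPoly (w₁ ∘ suc) ns y                          ≈⟨ symPoly-cong ns y w₁-suc ⟩
    symPoly (λ i → negTwo * w₁ i + w₀ i) ns y        ≈⟨ symPoly-+ (λ i → negTwo * w₁ i) w₀ ns y ⟩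
    symPoly (λ i → negTwo * w₁ i) ns y + symPoly w₀ ns y ≈⟨ +-congʳ (symPoly-*ˡ negTwo w₁ ns y) ⟩
    negTwo * symPoly w₁ ns y + symPoly w₀ ns y       ∎)))

  partDet-closedForm : ∀ {k} (ns : Vec ℕ k) → All (1 ≤_) ns → ∀ y t →
    partDet ns y t ≈ pow y (sum ns ∸ k) * (symPoly w₀ ns y + t * (symPoly w₁ ns y - symPoly w₀ ns y))
  partDet-closedForm [] [] y t = sym (begin
      1# * (symPoly w₀ [] y + t * (symPoly w₁ [] y - symPoly w₀ [] y))
    ≈⟨ *-identityˡ _ ⟩
      symPoly w₀ [] y + t * (symPoly w₁ [] y - symPoly w₀ [] y)
    ≈⟨ +-cong (symPoly-[] w₀ y) (*-congˡ (+-cong (symPoly-[] w₁ y) (-‿cong (symPoly-[] w₀ y)))) ⟩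
      1# + t * (1# - 1#)
    ≈⟨ +-congˡ (trans (*-congˡ (-‿inverseʳ 1#)) (zeroʳ t)) ⟩
      1# + 0#
    ≈⟨ +-identityʳ 1# ⟩
      1# ∎)
  partDet-closedForm {suc k} (suc m ∷ r) (_ ∷ positive) y t = begin
      partDet (suc m ∷ r) y t
    ≈⟨ partDet-firstPart m r y t ⟩
      pow y m * ((y - ℕ→R 2 * a) * partDet r y t + t * a * partDet r y 0#)
    ≈⟨ *-congˡ (+-cong (*-congˡ (partDet-closedForm r positive y t)) (*-congˡ (partDet-closedForm r positive y 0#))) ⟩
      pow y m * ((y - ℕ→R 2 * a) * (Y * (S₀ + t * (S₁ - S₀))) + t * a * (Y * (S₀ + 0# * (S₁ - S₀))))
    ≈⟨ regroup (pow y m) Y S₀ S₁ t y a ⟩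
      (pow y m * Y) * ((y * S₀ + a * (negTwo * S₀)) + t * ((y * S₁ + a * (negTwo * S₁ + S₀)) - (y * S₀ + a * (negTwo * S₀))))
    ≈⟨ *-cong powers (+-cong S₀′ (*-congˡ (+-cong S₁′ (-‿cong S₀′)))) ⟩
      pow y (suc m ℕ.+ sum r ∸ suc k) * (symPoly w₀ (suc m ∷ r) y + t * (symPoly w₁ (suc m ∷ r) y - symPoly w₀ (suc m ∷ r) y)) ∎
    where
    a = ℕ→R (suc m)
    Y = pow y (sum r ∸ k)
    S₀ = symPoly w₀ r y
    S₁ = symPoly w₁ r y
    S₀′ = sym (symPoly-w₀-∷ (suc m) r y)
    S₁′ = sym (symPoly-w₁-∷ (suc m) r y)
    powers : pow y m * Y ≈ pow y (m ℕ.+ sum r ∸ k)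
    powers = trans (sym (pow-+ y m (sum r ∸ k))) (reflexive (≡.cong (pow y) (≡.sym (ℕ.+-∸-assoc m (length≤sum r positive)))))
    regroup : ∀ P Y S₀ S₁ t y a →
      P * ((y - ℕ→R 2 * a) * (Y * (S₀ + t * (S₁ - S₀))) + t * a * (Y * (S₀ + 0# * (S₁ - S₀))))
        ≈ (P * Y) * ((y * S₀ + a * (negTwo * S₀)) + t * ((y * S₁ + a * (negTwo * S₁ + S₀)) - (y * S₀ + a * (negTwo * S₀))))
    regroup = solve 7 (λ P Y S₀ S₁ t y a →
      let S₀′ = y :* S₀ :+ a :* ((:- con (+ 2)) :* S₀)
          S₁′ = y :* S₁ :+ a :* ((:- con (+ 2)) :* S₁ :+ S₀)
      in P :* ((y :- con (+ 2) :* a) :* (Y :* (S₀ :+ t :* (S₁ :- S₀))) :+ t :* a :* (Y :* (S₀ :+ con (+ 0) :* (S₁ :- S₀))))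
           := (P :* Y) :* (S₀′ :+ t :* (S₁′ :- S₀′))) refl

  binomialWeight : ∀ {k} → Vec ℕ k → ℕ → ℕ → Carrier
  binomialWeight {k} ns i m = (w₁ i * ℕ→R (σ ns i)) * ℕ→R ((k ∸ i) C (m ∸ i))

  signedPowerOfTwo : ∀ j → pow (- ℕ→R 1) j * ℕ→R (2 ℕ.^ j) ≈ pow negTwo j
  signedPowerOfTwo zero    = trans (*-identityˡ _) (+-identityʳ 1#)
  signedPowerOfTwo (suc j) = begin
      (- ℕ→R 1 * pow (- ℕ→R 1) j) * ℕ→R (2 ℕ.* 2 ℕ.^ j)
    ≈⟨ *-congˡ (ℕ→R-* 2 (2 ℕ.^ j)) ⟩
      (- ℕ→R 1 * pow (- ℕ→R 1) j) * (ℕ→R 2 * ℕ→R (2 ℕ.^ j))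
    ≈⟨ solve 2 (λ P Q → ((:- con (+ 1)) :* P) :* (con (+ 2) :* Q) := (:- con (+ 2)) :* (P :* Q)) refl _ _ ⟩
      negTwo * (pow (- ℕ→R 1) j * ℕ→R (2 ℕ.^ j))
    ≈⟨ *-congˡ (signedPowerOfTwo j) ⟩
      pow negTwo (suc j) ∎

  term≈binomialWeight : ∀ {k} (ns : Vec ℕ k) m i → ℤ→R (term ns m i) ≈ binomialWeight ns i m
  term≈binomialWeight {k} ns m zero = sym (trans
    (*-congʳ (trans (*-identityˡ _) (trans (reflexive (≡.cong ℕ→R (σ-zero ns))) (+-identityʳ 1#))))
    (*-identityˡ _))
  term≈binomialWeight {k} ns m (suc j) = begin
      ℤ→R (A ℤ.* B)
    ≈⟨ trans (ℤ→R-* A B) (*-cong A≈ B≈) ⟩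
      (pow negTwo j * ℕ→R binom) * ((ℕ→R (suc j) - ℕ→R 2) * ℕ→R σⱼ)
    ≈⟨ solve 4 (λ P c d s → (P :* c) :* (d :* s) := ((P :* d) :* s) :* c) refl
         (pow negTwo j) (ℕ→R binom) (ℕ→R (suc j) - ℕ→R 2) (ℕ→R σⱼ) ⟩
      binomialWeight ns (suc j) m ∎
    where
    binom = (k ∸ suc j) C (m ∸ suc j)
    σⱼ = σ ns (suc j)
    sign = (ℤ.- (+ 1)) ℤ.^ j
    A = (sign ℤ.* (+ (2 ℕ.^ j))) ℤ.* (+ binom)
    B = (+ (suc j) ℤ.- + 2) ℤ.* (+ σⱼ)
    A≈ : ℤ→R A ≈ pow negTwo j * ℕ→R binom
    A≈ = begin
      ℤ→R A                                              ≈⟨ ℤ→R-* (sign ℤ.* (+ (2 ℕ.^ j))) (+ binom) ⟩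
      ℤ→R (sign ℤ.* (+ (2 ℕ.^ j))) * ℕ→R binom           ≈⟨ *-congʳ (ℤ→R-* sign (+ (2 ℕ.^ j))) ⟩
      (ℤ→R sign * ℕ→R (2 ℕ.^ j)) * ℕ→R binom             ≈⟨ *-congʳ (*-congʳ (ℤ→R-^ (ℤ.- (+ 1)) j)) ⟩
      (pow (- ℕ→R 1) j * ℕ→R (2 ℕ.^ j)) * ℕ→R binom      ≈⟨ *-congʳ (signedPowerOfTwo j) ⟩
      pow negTwo j * ℕ→R binom                           ∎
    B≈ : ℤ→R B ≈ (ℕ→R (suc j) - ℕ→R 2) * ℕ→R σⱼ
    B≈ = trans (ℤ→R-* (+ (suc j) ℤ.- + 2) (+ σⱼ)) (*-congʳ (ℤ→R-sub (+ (suc j)) (+ 2)))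

  binomialWeight₀ : ∀ {k} (ns : Vec ℕ k) m → binomialWeight ns 0 m ≈ ℕ→R (k C m)
  binomialWeight₀ ns m = sym (term≈binomialWeight ns m 0)

  binomialWeight₁ : ∀ {k} (ns : Vec ℕ k) m →
    binomialWeight ns 1 (suc m) ≈ ((ℕ→R 1 - ℕ→R 2) * ℕ→R (sum ns)) * ℕ→R ((k ∸ 1) C m)
  binomialWeight₁ ns m = *-congʳ (*-cong (*-identityˡ _) (reflexive (≡.cong ℕ→R (σ-one ns))))

  ℤ→R-sumℤ : ∀ m (f : ℕ → ℤ) → ℤ→R (sumℤ m f) ≈ ΣR m (ℤ→R ∘ f)
  ℤ→R-sumℤ zero    f = refl
  ℤ→R-sumℤ (suc m) f = trans (ℤ→R-+ (sumℤ m f) (f (suc m))) (+-congʳ (ℤ→R-sumℤ m f))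

  coeff≈ΣbinomialWeight : ∀ {k} (ns : Vec ℕ k) m → ℤ→R (coeff ns m) ≈ ΣR m (λ i → binomialWeight ns i m)
  coeff≈ΣbinomialWeight {k} ns zero = term≈binomialWeight ns 0 0
  coeff≈ΣbinomialWeight {k} ns (suc zero) = begin
      ℤ→R (+ k ℤ.- + sum ns)
    ≈⟨ ℤ→R-sub (+ k) (+ sum ns) ⟩
      ℕ→R k - ℕ→R (sum ns)
    ≈⟨ solve 2 (λ K s → K :- s := K :+ ((con (+ 1) :- con (+ 2)) :* s) :* con (+ 1)) refl (ℕ→R k) (ℕ→R (sum ns)) ⟩
      ℕ→R k + ((ℕ→R 1 - ℕ→R 2) * ℕ→R (sum ns)) * ℕ→R 1
    ≈⟨ +-cong (trans (binomialWeight₀ ns 1) (reflexive (≡.cong ℕ→R (nC1≡n k)))) (binomialWeight₁ ns 0) ⟨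
      binomialWeight ns 0 1 + binomialWeight ns 1 1 ∎
  coeff≈ΣbinomialWeight {k} ns (suc (suc zero)) = begin
      ℤ→R (+ (k C 2) ℤ.- + (k ∸ 1) ℤ.* + sum ns)
    ≈⟨ trans (ℤ→R-sub (+ (k C 2)) (+ (k ∸ 1) ℤ.* + sum ns)) (+-congˡ (-‿cong (ℤ→R-* (+ (k ∸ 1)) (+ sum ns)))) ⟩
      ℕ→R (k C 2) - ℕ→R (k ∸ 1) * ℕ→R (sum ns)
    ≈⟨ solve 4 (λ K K₁ s s₂ → K :- K₁ :* s
         := (K :+ ((con (+ 1) :- con (+ 2)) :* s) :* K₁) :+ (((:- con (+ 2)) :* (con (+ 2) :- con (+ 2))) :* s₂) :* con (+ 1)) refl
         (ℕ→R (k C 2)) (ℕ→R (k ∸ 1)) (ℕ→R (sum ns)) (ℕ→R (σ ns 2)) ⟩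
      (ℕ→R (k C 2) + ((ℕ→R 1 - ℕ→R 2) * ℕ→R (sum ns)) * ℕ→R (k ∸ 1))
        + ((negTwo * (ℕ→R 2 - ℕ→R 2)) * ℕ→R (σ ns 2)) * ℕ→R 1
    ≈⟨ +-cong (+-cong (binomialWeight₀ ns 2) (trans (binomialWeight₁ ns 1) (*-congˡ (reflexive (≡.cong ℕ→R (nC1≡n (k ∸ 1)))))))
              (*-congʳ (*-congʳ (*-congʳ (*-identityʳ negTwo)))) ⟨
      (binomialWeight ns 0 2 + binomialWeight ns 1 2) + binomialWeight ns 2 2 ∎
  coeff≈ΣbinomialWeight {k} ns m@(suc (suc (suc _))) =
    trans (ℤ→R-sumℤ m (term ns m)) (ΣR-cong m (λ i _ → term≈binomialWeight ns m i))

  rhsFactor : ∀ {k} → Vec ℕ k → Carrier → Carrier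
  rhsFactor {k} ns x = ΣR k (λ m → ℤ→R (coeff ns m) * pow x (k ∸ m))

  -- Exchanging the sums over m and i leaves, for each i, a binomial expansion of (x + 1)^(k-i).
  rhsFactor≈symPoly : ∀ {k} (ns : Vec ℕ k) x → rhsFactor ns x ≈ symPoly w₁ ns (x + 1#)
  rhsFactor≈symPoly {k} ns x = begin
      ΣR k (λ m → ℤ→R (coeff ns m) * pow x (k ∸ m))
    ≈⟨ ΣR-cong k (λ m _ → trans (*-congʳ (coeff≈ΣbinomialWeight ns m))
                                (sym (ΣR-*ʳ m (pow x (k ∸ m)) (λ i → binomialWeight ns i m)))) ⟩
      ΣR k (λ m → ΣR m (λ i → h i m))
    ≈⟨ ΣR-triangle k h ⟩
      ΣR k (λ i → ΣR (k ∸ i) (λ p → h i (i ℕ.+ p)))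
    ≈⟨ ΣR-cong k (λ i _ → trans (ΣR-cong (k ∸ i) (λ p _ → shift i p)) (ΣR-*ˡ (k ∸ i) (w₁ i * ℕ→R (σ ns i)) _)) ⟩
      ΣR k (λ i → (w₁ i * ℕ→R (σ ns i)) * ΣR (k ∸ i) (λ p → ℕ→R ((k ∸ i) C p) * pow x ((k ∸ i) ∸ p)))
    ≈⟨ ΣR-cong k (λ i _ → *-congˡ (sym (binomial x (k ∸ i)))) ⟩
      symPoly w₁ ns (x + 1#) ∎
    where
    h : ℕ → ℕ → Carrier
    h i m = binomialWeight ns i m * pow x (k ∸ m)
    shift : ∀ i p → h i (i ℕ.+ p) ≈ (w₁ i * ℕ→R (σ ns i)) * (ℕ→R ((k ∸ i) C p) * pow x ((k ∸ i) ∸ p))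
    shift i p = trans
      (*-cong (*-congˡ (reflexive (≡.cong (λ q → ℕ→R ((k ∸ i) C q)) (ℕ.m+n∸m≡n i p))))
              (reflexive (≡.cong (pow x) (≡.sym (ℕ.∸-+-assoc k i p)))))
      (*-assoc _ _ _)

theorem2p7 : ∀ {c ℓ} (R : CommutativeRing c ℓ) (k : ℕ) (ns : Vec ℕ k)
    → 1 ≤ k → All (λ nᵢ → 1 ≤ nᵢ) ns → (x : CommutativeRing.Carrier R)
    → CommutativeRing._≈_ R (RingDefs.seidelCharPoly R ns x) (RingDefs.rhs R ns x)
theorem2p7 R k ns _ positive x = begin
    seidelCharPoly ns x
  ≈⟨ det-cong (sum ns) (charMat≈partMatrix ns x) ⟩
    partDet ns y 1#
  ≈⟨ partDet-closedForm ns positive y 1# ⟩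
    pow y (sum ns ℕ.∸ k) * (S₀ + 1# * (S₁ - S₀))
  ≈⟨ *-congˡ (trans (+-congˡ (*-identityˡ _)) (solve 2 (λ a b → a :+ (b :- a) := b) refl S₀ S₁)) ⟩
    pow y (sum ns ℕ.∸ k) * S₁
  ≈⟨ *-congˡ (rhsFactor≈symPoly ns x) ⟨
    rhs ns x ∎
  where
  open CommutativeRing R
  open RingDefs R
  open IntegerEmbedding R
  open Determinant R
  open PartMatrix R
  open ClosedForm R
  open import Relation.Binary.Reasoning.Setoid setoid
  y = x + 1#
  S₀ = symPoly w₀ ns y
  S₁ = symPoly w₁ ns y
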